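{- Let $p=\underline{p_1p_2\cdots p_\ell}$ be a consecutive pattern with $\{p_1,p_\ell\}\ne\{1,\ell\}$. If the index $\ell$ is the unique extendable index of $p$, then the property "to have two occurrences of $p$" is unstable, and hence the pattern $p$ is unstable.
   Context: $M(k_1,\ldots,k_n)$ is the multiset containing the letter $j$ exactly $k_j$ times; a permutation of it is a word in which each letter $j$ occurs exactly $k_j$ times. A consecutive pattern $p=\underline{p_1\cdots p_\ell}$ is a permutation $p_1\cdots p_\ell$ of $\{1,\ldots,\ell\}$; a factor $\pi_a\cdots\pi_{a+\ell-1}$ of a word forms an occurrence of $p$ if for all $j,k$, $\pi_{a+j-1}<\pi_{a+k-1}$ iff $p_j<p_k$. $M^*(p;s)$ is the set of permutations of $M$ with exactly $s$ occurrences of $p$. An index $i$ with $2\le i\le\ell$ is extendable if there is a word $\pi_1\cdots\pi_{\ell+i-1}$ over positive integers whose first $\ell$ letters and whose last $\ell$ letters each form an occurrence of $p$. The property "to have two occurrences of $p$" is unstable if there exist $n$, $(k_1,\ldots,k_n)\in\mathbb N^n$, $\tau\in\mathfrak S_n$ with $|M(k_1,\ldots,k_n)^*(p;2)|\ne|M(k_{\tau^{ -1}(1)},\ldots,k_{\tau^{ -1}(n)})^*(p;2)|$; the pattern $p$ is unstable if such an inequality holds for some $s$ in place of $2$. -}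

module Defs where

open import Data.Bool using (Bool; true; false; _∧_; if_then_else_; T; T?)
open import Data.Bool.ListAction using (and)
open import Data.Nat.ListAction using (sum)
open import Data.Bool.Properties using () renaming (_≟_ to _≟ᵇ_)
open import Data.Nat using (ℕ; zero; suc; _+_; _∸_; _≤_; _<_; _<ᵇ_; _≡ᵇ_)
open import Data.Fin using (Fin; toℕ; fromℕ)
import Data.Fin as Fin
open import Data.Fin.Permutation using (Permutation′; _⟨$⟩ʳ_; _⟨$⟩ˡ_)
open import Data.List using (List; []; _∷_; length; map; concatMap; filter; upTo; allFin)
open import Data.List.Relation.Unary.All using (All)
open import Data.Product using (Σ; ∃; _×_)
open import Relation.Binary.PropositionalEquality using (_≡_; _≢_)
open import Relation.Nullary.Decidable using (does)
open import Relation.Unary using (Pred)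
import Data.Nat as ℕ

-- A consecutive pattern of length ℓ: a permutation of {1,…,ℓ}.
-- p_j (1-based value, 1-based position j) is  suc (toℕ (π ⟨$⟩ʳ (j-1))).
Pattern : ℕ → Set
Pattern ℓ = Permutation′ ℓ

pval : ∀ {ℓ} → Pattern ℓ → Fin ℓ → ℕ
pval p j = suc (toℕ (p ⟨$⟩ʳ j))

-- Words over positive integers are lists of naturals.
-- Letter at 0-based position i (0 if out of range; only used in range).
at : List ℕ → ℕ → ℕ
at []       _       = 0
at (x ∷ w)  zero    = x
at (x ∷ w)  (suc i) = at w i

_==ᵇ_ : Bool → Bool → Bool
a ==ᵇ b = does (a ≟ᵇ b)

isOcc : ∀ {ℓ} → Pattern ℓ → List ℕ → ℕ → Bool
isOcc {ℓ} p w a =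
  ((a + ℓ) ℕ.≤ᵇ length w) ∧
  and (concatMap (λ j → map (λ k →
        (at w (a + toℕ j) <ᵇ at w (a + toℕ k)) ==ᵇ (pval p j <ᵇ pval p k))
      (allFin ℓ)) (allFin ℓ))

occurrences : ∀ {ℓ} → Pattern ℓ → List ℕ → ℕ
occurrences p w = length (filter (λ a → T? (isOcc p w a)) (upTo (length w)))

Extendable : ∀ {ℓ} → Pattern ℓ → ℕ → Set
Extendable {ℓ} p i =
  2 ≤ i × i ≤ ℓ ×
  Σ (List ℕ) (λ w → length w ≡ ℓ + i ∸ 1 × All (0 <_) w ×
                    T (isOcc p w 0) × T (isOcc p w (i ∸ 1)))

UniqueExtendableℓ : ∀ {ℓ} → Pattern ℓ → Set
UniqueExtendableℓ {ℓ} p = Extendable p ℓ × (∀ i → Extendable p i → i ≡ ℓ)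

Σk : ∀ {n} → (Fin n → ℕ) → ℕ
Σk {n} k = sum (map k (allFin n))

allWords : ℕ → ℕ → List (List ℕ)
allWords n zero    = [] ∷ []
allWords n (suc m) = concatMap (λ a → map (a ∷_) (allWords n m)) (map suc (upTo n))

countLetter : ℕ → List ℕ → ℕ
countLetter a [] = 0
countLetter a (x ∷ w) = if x ≡ᵇ a then suc (countLetter a w) else countLetter a w

-- w is a permutation of M(k_1,…,k_n): letter j occurs exactly k_j times
-- (for words of length Σ k over {1,…,n})
isPermOfM : ∀ {n} → (Fin n → ℕ) → List ℕ → Bool
isPermOfM {n} k w = and (map (λ j → countLetter (suc (toℕ j)) w ≡ᵇ k j) (allFin n))

countMstar : ∀ {n ℓ} → (Fin n → ℕ) → Pattern ℓ → ℕ → ℕ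
countMstar {n} k p s =
  length (filter (λ w → T? (isPermOfM k w ∧ (occurrences p w ≡ᵇ s)))
                 (allWords n (Σk k)))

UnstableProperty : ∀ {ℓ} → Pattern ℓ → ℕ → Set
UnstableProperty p s =
  Σ ℕ λ n → Σ (Fin n → ℕ) λ k → Σ (Permutation′ n) λ τ →
    countMstar k p s ≢ countMstar (λ j → k (τ ⟨$⟩ˡ j)) p s

UnstablePattern : ∀ {ℓ} → Pattern ℓ → Set
UnstablePattern p = Σ ℕ λ s → UnstableProperty p s

module Submission where

-- As ℓ is the only extendable index, two occurrences of p in a positive word overlap in at most
-- one letter. Hence a word of length 2ℓ - 1 with two occurrences has them at both ends, sharing
-- the middle letter, and a letter occurring twice in it occurs once in each occurrence, before
-- resp. after the middle. If p₁ or p_ℓ is ℓ, the middle letter is the largest letter of one of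
-- the occurrences, so no repeated letter exceeds it and the largest letter of the alphabet is
-- never repeated. Otherwise, if the letters 1, …, μ are all repeated, they lie below the middle
-- and take μ distinct ranks below p_ℓ in the first occurrence and below p₁ in the second, so
-- μ < min(p₁, p_ℓ). Conversely there are words with two occurrences repeating the letter 1
-- (first case, where neither end of p is 1), resp. the letters below min(p₁, p_ℓ) and one more
-- letter (second case); transposing that letter with the largest letter, resp. with
-- min(p₁, p_ℓ), gives a multiset none of whose permutations has two occurrences.

open import Defs
open import Data.Nat using (ℕ; suc)
open import Data.Fin using (zero; fromℕ)
open import Data.Product using (_×_)
open import Data.Sum using (_⊎_)
open import Relation.Binary.PropositionalEquality using (_≡_)
open import Relation.Nullary using (¬_)

import Algebra.Properties.CommutativeMonoid.Sum
open import Data.Bool using (Bool; true; false; T; T?; _∧_; if_then_else_)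
open import Data.Bool.ListAction using (and)
open import Data.Bool.Properties using (T-∧)
open import Data.Fin using (Fin; toℕ; fromℕ<)
import Data.Fin as Fin
open import Data.Fin.Properties
  using (toℕ-injective; toℕ-fromℕ<; toℕ-fromℕ; toℕ<n; injective⇒≤; fromℕ<-cong)
open import Data.Fin.Permutation
  using (Permutation′; _⟨$⟩ʳ_; _⟨$⟩ˡ_; inverseˡ; inverseʳ; flip; transpose)
open import Data.List
  using (List; []; _∷_; _++_; length; map; concatMap; allFin; take; drop; filter; applyUpTo; upTo;
         tabulate)
open import Data.List.Membership.Propositional using (_∈_)
open import Data.List.Membership.Propositional.Properties
  using (∈-allFin; ∈-filter⁺; ∈-concat⁻′; ∈-concat⁺′; ∈-map⁻; ∈-map⁺; ∈-upTo⁻; ∈-upTo⁺)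
open import Data.List.Properties
  using (length-take; length-drop; length-++; length-tabulate; map-tabulate; filter-none)
open import Data.List.Relation.Unary.All as All using (All; []; _∷_)
import Data.List.Relation.Unary.All.Properties as All
open import Data.List.Relation.Unary.Any using (here; there)
open import Data.Nat
  using (zero; _+_; _∸_; _⊓_; _≤_; _<_; _<ᵇ_; _≡ᵇ_; z≤n; s≤s; s≤s⁻¹; z<s; s<s)
open import Data.Nat.ListAction using (sum)
open import Data.Nat.Properties
open import Data.Product using (∃-syntax; _,_; proj₁; proj₂)
open import Data.Sum using (inj₁; inj₂; [_,_]′)
open import Function using (_∘_; id; _⇔_; mk⇔; Injective)
open import Function.Bundles using (module Equivalence)
open import Relation.Binary using (_Preserves_⟶_; tri<; tri≈; tri>)
open import Relation.Binary.PropositionalEquality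
  using (refl; sym; trans; cong; cong₂; subst; subst₂; _≢_; _≗_; module ≡-Reasoning)
open import Relation.Nullary using (yes; no; contradiction)

open Equivalence using (to; from)

T-and : ∀ bs → T (and bs) ⇔ All T bs
T-and bs = mk⇔ (to′ bs) from′
  where
  to′ : ∀ bs → T (and bs) → All T bs
  to′ []          _ = []
  to′ (true ∷ bs) t = _ ∷ to′ bs t
  from′ : ∀ {bs} → All T bs → T (and bs)
  from′ []                  = _
  from′ {true ∷ _} (_ ∷ ts) = from′ ts

T-and-allFin² : ∀ {n} (e : Fin n → Fin n → Bool) →
  T (and (concatMap (λ j → map (e j) (allFin n)) (allFin n))) ⇔ (∀ j k → T (e j k))
T-and-allFin² {n} e = mk⇔
  (λ t j k → All.lookup
    (All.map⁻ (All.lookup (All.map⁻ (All.concat⁻ (to (T-and _) t))) (∈-allFin j))) (∈-allFin k))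
  (λ t → from (T-and _) (All.concat⁺ (All.map⁺ (All.tabulate⁺ λ j → All.map⁺ (All.tabulate⁺ (t j))))))

T-==ᵇ : ∀ a b → T (a ==ᵇ b) ⇔ (T a ⇔ T b)
T-==ᵇ false false = mk⇔ (λ _ → mk⇔ id id) _
T-==ᵇ false true  = mk⇔ (λ ()) (λ a⇔b → from a⇔b _)
T-==ᵇ true  false = mk⇔ (λ ()) (λ a⇔b → to a⇔b _)
T-==ᵇ true  true  = mk⇔ (λ _ → mk⇔ id id) _

T-<ᵇ-==ᵇ : ∀ x y u v → T ((x <ᵇ y) ==ᵇ (u <ᵇ v)) ⇔ (x < y ⇔ u < v)
T-<ᵇ-==ᵇ x y u v = mk⇔
  (λ t → let x<y⇔u<v = to (T-==ᵇ _ _) t in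
    mk⇔ (<ᵇ⇒< u v ∘ to x<y⇔u<v ∘ <⇒<ᵇ) (<ᵇ⇒< x y ∘ from x<y⇔u<v ∘ <⇒<ᵇ))
  (λ x<y⇔u<v → from (T-==ᵇ _ _)
    (mk⇔ (<⇒<ᵇ ∘ to x<y⇔u<v ∘ <ᵇ⇒< x y) (<⇒<ᵇ ∘ from x<y⇔u<v ∘ <ᵇ⇒< u v)))

-- Occurrences as order-isomorphic factors

SameOrder : ∀ {ℓ} → (Fin ℓ → ℕ) → (Fin ℓ → ℕ) → Set
SameOrder f g = ∀ j k → f j < f k ⇔ g j < g k

sameOrder-congˡ : ∀ {ℓ} {f f′ g : Fin ℓ → ℕ} → f ≗ f′ → SameOrder f g → SameOrder f′ g
sameOrder-congˡ {g = g} f≗f′ so j k = subst₂ (λ x y → x < y ⇔ g j < g k) (f≗f′ j) (f≗f′ k) (so j k)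

strictlyIncreasing-sameOrder : ∀ {ℓ} {h : ℕ → ℕ} → h Preserves _<_ ⟶ _<_ →
  (g : Fin ℓ → ℕ) → SameOrder (h ∘ g) g
strictlyIncreasing-sameOrder {h = h} h-mono g j k = mk⇔ reflect h-mono
  where
  reflect : h (g j) < h (g k) → g j < g k
  reflect lt with <-cmp (g j) (g k)
  ... | tri< gj<gk _ _ = gj<gk
  ... | tri≈ _ gj≡gk _ = contradiction (cong h gj≡gk) (<⇒≢ lt)
  ... | tri> _ _ gj>gk = contradiction lt (<⇒≯ (h-mono gj>gk))

sameOrder-injective : ∀ {ℓ} {f g : Fin ℓ → ℕ} → SameOrder f g →
  Injective _≡_ _≡_ g → Injective _≡_ _≡_ f
sameOrder-injective {f = f} {g} so g-inj {j} {k} fj≡fk with <-cmp (g j) (g k)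
... | tri< gj<gk _ _ = contradiction fj≡fk (<⇒≢ (from (so j k) gj<gk))
... | tri≈ _ gj≡gk _ = g-inj gj≡gk
... | tri> _ _ gj>gk = contradiction (sym fj≡fk) (<⇒≢ (from (so k j) gj>gk))

injective-bounded⇒≤ : ∀ {μ b} (h : Fin μ → ℕ) → Injective _≡_ _≡_ h → (∀ y → h y < b) → μ ≤ b
injective-bounded⇒≤ h h-inj h<b = injective⇒≤ {f = λ y → fromℕ< (h<b y)} λ {x} {y} e →
  h-inj (trans (sym (toℕ-fromℕ< (h<b x))) (trans (cong toℕ e) (toℕ-fromℕ< (h<b y))))

module _ {ℓ : ℕ} (p : Pattern ℓ) where

  -- 0-based: pval p j ≡ suc (rank p j).
  rank : Fin ℓ → ℕ
  rank j = toℕ (p ⟨$⟩ʳ j)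

  rank-injective : Injective _≡_ _≡_ rank
  rank-injective e = trans (sym (inverseˡ p)) (trans (cong (p ⟨$⟩ˡ_) (toℕ-injective e)) (inverseˡ p))

  rank<ℓ : ∀ j → rank j < ℓ
  rank<ℓ j = toℕ<n (p ⟨$⟩ʳ j)

  rank-inverse : ∀ i → rank (p ⟨$⟩ˡ i) ≡ toℕ i
  rank-inverse i = cong toℕ (inverseʳ p)

at-drop : ∀ s w i → at (drop s w) i ≡ at w (s + i)
at-drop zero    w       i = refl
at-drop (suc s) []      i = refl
at-drop (suc s) (x ∷ w) i = at-drop s w i

at-take : ∀ t w i → i < t → at (take t w) i ≡ at w i
at-take (suc t) []      i       _   = refl
at-take (suc t) (x ∷ w) zero    _   = refl
at-take (suc t) (x ∷ w) (suc i) i<t = at-take t w i (s≤s⁻¹ i<t)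

at-++ˡ : ∀ xs ys i → i < length xs → at (xs ++ ys) i ≡ at xs i
at-++ˡ (x ∷ xs) ys zero    _     = refl
at-++ˡ (x ∷ xs) ys (suc i) i<len = at-++ˡ xs ys i (s≤s⁻¹ i<len)

at-++ʳ : ∀ xs ys i → at (xs ++ ys) (length xs + i) ≡ at ys i
at-++ʳ []       ys i = refl
at-++ʳ (x ∷ xs) ys i = at-++ʳ xs ys i

at-tabulate : ∀ {n} (f : Fin n → ℕ) j → at (tabulate f) (toℕ j) ≡ f j
at-tabulate f zero        = refl
at-tabulate f (Fin.suc j) = at-tabulate (f ∘ Fin.suc) j

All-at : ∀ {P : ℕ → Set} {w} → All P w → ∀ {i} → i < length w → P (at w i)
All-at (px ∷ _)  {zero}  _     = px
All-at (_ ∷ pxs) {suc i} i<len = All-at pxs (s≤s⁻¹ i<len)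

factor : ∀ {ℓ} → List ℕ → ℕ → Fin ℓ → ℕ
factor w a j = at w (a + toℕ j)

record OccursAt {ℓ} (p : Pattern ℓ) (w : List ℕ) (a : ℕ) : Set where
  constructor occursAt
  field
    fits    : a + ℓ ≤ length w
    ordered : SameOrder (factor w a) (rank p)

module _ {ℓ : ℕ} (p : Pattern ℓ) where

  isOcc⇔OccursAt : ∀ w a → T (isOcc p w a) ⇔ OccursAt p w a
  isOcc⇔OccursAt w a = mk⇔
    (λ t → let (fits , ordered) = to T-∧ t in
      occursAt (≤ᵇ⇒≤ (a + ℓ) (length w) fits)
        λ j k → to (T-<ᵇ-==ᵇ _ _ (rank p j) (rank p k)) (to (T-and-allFin² _) ordered j k))
    (λ (occursAt fits so) → from T-∧ (≤⇒≤ᵇ fits ,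
      from (T-and-allFin² _) λ j k → from (T-<ᵇ-==ᵇ _ _ (rank p j) (rank p k)) (so j k)))

  factor-fromℕ< : ∀ w {a i} → a ≤ i → (lt : i ∸ a < ℓ) → factor w a (fromℕ< lt) ≡ at w i
  factor-fromℕ< w {a} a≤i lt = cong (at w) (trans (cong (a +_) (toℕ-fromℕ< lt)) (m+[n∸m]≡n a≤i))

  occursAt-distinct : ∀ {w a i j} → OccursAt p w a → a ≤ i → i < j → j < a + ℓ → at w i ≢ at w j
  occursAt-distinct {w} {a} {i} {j} (occursAt _ so) a≤i i<j j<a+ℓ wi≡wj = <⇒≢ i<j i≡j
    where
    a≤j : a ≤ j
    a≤j = <⇒≤ (≤-<-trans a≤i i<j)
    j∸a<ℓ : j ∸ a < ℓ
    j∸a<ℓ = +-cancelˡ-< a (j ∸ a) ℓ (subst (_< a + ℓ) (sym (m+[n∸m]≡n a≤j)) j<a+ℓ)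
    i∸a<ℓ : i ∸ a < ℓ
    i∸a<ℓ = ≤-<-trans (∸-monoˡ-≤ a (<⇒≤ i<j)) j∸a<ℓ
    same-index : fromℕ< i∸a<ℓ ≡ fromℕ< j∸a<ℓ
    same-index = sameOrder-injective so (rank-injective p)
      (trans (factor-fromℕ< w a≤i i∸a<ℓ) (trans wi≡wj (sym (factor-fromℕ< w a≤j j∸a<ℓ))))
    i≡j : i ≡ j
    i≡j = begin
      i           ≡⟨ m+[n∸m]≡n a≤i ⟨
      a + (i ∸ a) ≡⟨ cong (a +_) (trans (sym (toℕ-fromℕ< i∸a<ℓ))
                                        (trans (cong toℕ same-index) (toℕ-fromℕ< j∸a<ℓ))) ⟩
      a + (j ∸ a) ≡⟨ m+[n∸m]≡n a≤j ⟩
      j           ∎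
      where open ≡-Reasoning

  occursAt-rank-bound : ∀ {w a μ} → OccursAt p w a → (q : Fin ℓ) (I : Fin μ → Fin ℓ) →
    (∀ y → factor w a (I y) ≡ suc (toℕ y)) → (∀ y → suc (toℕ y) < factor w a q) → μ ≤ rank p q
  occursAt-rank-bound {w} {a} (occursAt _ so) q I letter below =
    injective-bounded⇒≤ (rank p ∘ I) rank∘I-injective
      (λ y → to (so (I y) q) (subst (_< factor w a q) (sym (letter y)) (below y)))
    where
    rank∘I-injective : Injective _≡_ _≡_ (rank p ∘ I)
    rank∘I-injective {y} {y′} e = toℕ-injective (suc-injective
      (trans (sym (letter y)) (trans (cong (factor w a) (rank-injective p e)) (letter y′))))

  occursAt-window : ∀ {w} s {a} t → OccursAt p w (s + a) → a + ℓ ≤ t →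
    OccursAt p (take t (drop s w)) a
  occursAt-window {w} s {a} t (occursAt fits so) a+ℓ≤t = occursAt fits′ (sameOrder-congˡ letters so)
    where
    letters : factor w (s + a) ≗ factor (take t (drop s w)) a
    letters j = sym (begin
      at (take t (drop s w)) (a + toℕ j) ≡⟨ at-take t (drop s w) _
                                              (<-≤-trans (+-monoʳ-< a (toℕ<n j)) a+ℓ≤t) ⟩
      at (drop s w) (a + toℕ j)          ≡⟨ at-drop s w _ ⟩
      at w (s + (a + toℕ j))             ≡⟨ cong (at w) (+-assoc s a (toℕ j)) ⟨
      factor w (s + a) j                 ∎)
      where open ≡-Reasoning
    fits′ : a + ℓ ≤ length (take t (drop s w))
    fits′ = subst (a + ℓ ≤_) (sym (trans (length-take t (drop s w)) (cong (t ⊓_) (length-drop s w))))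
      (⊓-glb a+ℓ≤t (m+n≤o⇒m≤o∸n (a + ℓ)
        (subst (_≤ length w) (trans (+-assoc s a ℓ) (+-comm s (a + ℓ))) fits)))

module _ {m : ℕ} (p : Pattern (suc m)) where

  rank≤m : ∀ j → rank p j ≤ m
  rank≤m j = s≤s⁻¹ (rank<ℓ p j)

  occursAt-max : ∀ {w a} → OccursAt p w a → (q : Fin (suc m)) → rank p q ≡ m →
    ∀ j → factor w a j ≤ factor w a q
  occursAt-max (occursAt _ so) q rq≡m j = ≮⇒≥ λ q<j →
    <⇒≱ (to (so q j) q<j) (subst (rank p j ≤_) (sym rq≡m) (rank≤m j))

  occurrences⇒extendable : ∀ {w s d} → All (0 <_) w → OccursAt p w s → OccursAt p w (s + d) →
    1 ≤ d → d ≤ m → Extendable p (suc d)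
  occurrences⇒extendable {w} {s} {d} pos oₛ oₛ₊d 1≤d d≤m =
    s≤s 1≤d , s≤s d≤m , u , length-u , All.take⁺ (suc m + d) (All.drop⁺ s pos) ,
    from (isOcc⇔OccursAt p u 0) first , from (isOcc⇔OccursAt p u d) second
    where
    u : List ℕ
    u = take (suc m + d) (drop s w)
    first : OccursAt p u 0
    first = occursAt-window p s (suc m + d) (subst (OccursAt p w) (sym (+-identityʳ s)) oₛ)
      (m≤m+n (suc m) d)
    second : OccursAt p u d
    second = occursAt-window p s (suc m + d) oₛ₊d (≤-reflexive (+-comm d (suc m)))
    length-u : length u ≡ suc m + suc d ∸ 1
    length-u = trans
      (≤-antisym (subst (_≤ suc m + d) (sym (length-take (suc m + d) (drop s w))) (m⊓n≤m _ _))
                 (subst (_≤ length u) (+-comm d (suc m)) (OccursAt.fits second)))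
      (sym (+-suc m d))

  occurrence-gap : UniqueExtendableℓ p → ∀ {w s d} → All (0 <_) w →
    OccursAt p w s → OccursAt p w (s + d) → 1 ≤ d → d ≤ m → d ≡ m
  occurrence-gap (_ , unique) {d = d} pos oₛ oₛ₊d 1≤d d≤m =
    suc-injective (unique (suc d) (occurrences⇒extendable pos oₛ oₛ₊d 1≤d d≤m))

  occurrences-at-ends : UniqueExtendableℓ p → ∀ {w s t} → length w ≡ suc m + m → All (0 <_) w →
    OccursAt p w s → OccursAt p w t → s < t → s ≡ 0 × t ≡ m
  occurrences-at-ends ue {w} {s} {t} len pos oₛ oₜ s<t = s≡0 , trans t≡s+m (cong (_+ m) s≡0)
    where
    s+[t∸s]≡t : s + (t ∸ s) ≡ t
    s+[t∸s]≡t = m+[n∸m]≡n (<⇒≤ s<t)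
    t≤m : t ≤ m
    t≤m = +-cancelʳ-≤ (suc m) t m
      (subst (t + suc m ≤_) (trans len (+-comm (suc m) m)) (OccursAt.fits oₜ))
    t∸s≡m : t ∸ s ≡ m
    t∸s≡m = occurrence-gap ue pos oₛ (subst (OccursAt p w) (sym s+[t∸s]≡t) oₜ)
      (m<n⇒0<n∸m s<t) (≤-trans (m∸n≤m t s) t≤m)
    t≡s+m : t ≡ s + m
    t≡s+m = trans (sym s+[t∸s]≡t) (cong (s +_) t∸s≡m)
    s≡0 : s ≡ 0
    s≡0 = n≤0⇒n≡0 (+-cancelʳ-≤ m s 0 (subst (_≤ m) t≡s+m t≤m))

count : (ℕ → Bool) → ℕ → ℕ
count b zero    = 0
count b (suc n) = if b 0 then suc (count (b ∘ suc) n) else count (b ∘ suc) n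

length-filter-applyUpTo : ∀ (b : ℕ → Bool) (f : ℕ → ℕ) n →
  length (filter (λ a → T? (b a)) (applyUpTo f n)) ≡ count (b ∘ f) n
length-filter-applyUpTo b f zero = refl
length-filter-applyUpTo b f (suc n) with b (f 0)
... | true  = cong suc (length-filter-applyUpTo b (f ∘ suc) n)
... | false = length-filter-applyUpTo b (f ∘ suc) n

count≥1⇒∃ : ∀ b n → 1 ≤ count b n → ∃[ s ] s < n × T (b s)
count≥1⇒∃ b (suc n) c≥1 with b 0 in b0
... | true  = 0 , z<s , subst T (sym b0) _
... | false with count≥1⇒∃ (b ∘ suc) n c≥1
...   | s , s<n , bs = suc s , s<s s<n , bs

count≥2⇒∃₂ : ∀ b n → 2 ≤ count b n → ∃[ s ] ∃[ t ] s < t × t < n × T (b s) × T (b t)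
count≥2⇒∃₂ b (suc n) c≥2 with b 0 in b0
... | true with count≥1⇒∃ (b ∘ suc) n (s≤s⁻¹ c≥2)
...   | t , t<n , bt = 0 , suc t , z<s , s<s t<n , subst T (sym b0) _ , bt
count≥2⇒∃₂ b (suc n) c≥2 | false with count≥2⇒∃₂ (b ∘ suc) n c≥2
...   | s , t , s<t , t<n , bs , bt = suc s , suc t , s<s s<t , s<s t<n , bs , bt

∃⇒count≥1 : ∀ b n {s} → s < n → T (b s) → 1 ≤ count b n
∃⇒count≥1 b (suc n) {zero} _ b0 with b 0
... | true = s≤s z≤n
∃⇒count≥1 b (suc n) {suc s} s<n bs with b 0
... | true  = s≤s z≤n
... | false = ∃⇒count≥1 (b ∘ suc) n (s≤s⁻¹ s<n) bs

∃₂⇒count≥2 : ∀ b n {s t} → s < t → t < n → T (b s) → T (b t) → 2 ≤ count b n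
∃₂⇒count≥2 b (suc n) {zero} {suc t} _ t<n b0 bt with b 0
... | true = s≤s (∃⇒count≥1 (b ∘ suc) n (s≤s⁻¹ t<n) bt)
∃₂⇒count≥2 b (suc n) {suc s} {suc t} s<t t<n bs bt with b 0
... | true  = ≤-trans (∃₂⇒count≥2 (b ∘ suc) n (s≤s⁻¹ s<t) (s≤s⁻¹ t<n) bs bt) (n≤1+n _)
... | false = ∃₂⇒count≥2 (b ∘ suc) n (s≤s⁻¹ s<t) (s≤s⁻¹ t<n) bs bt

count≡0 : ∀ b n → (∀ s → ¬ T (b s)) → count b n ≡ 0
count≡0 b zero    _    = refl
count≡0 b (suc n) none with b 0 in b0
... | true  = contradiction (subst T (sym b0) _) (none 0)
... | false = count≡0 (b ∘ suc) n (none ∘ suc)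

count≡1 : ∀ b n {M} → M < n → T (b M) → (∀ s → T (b s) → s ≡ M) → count b n ≡ 1
count≡1 b (suc n) {zero} _ b0 only with b 0
... | true = cong suc (count≡0 (b ∘ suc) n λ s bs → 0≢1+n (sym (only (suc s) bs)))
count≡1 b (suc n) {suc M} M<n bM only with b 0 in b0
... | true  = contradiction (only 0 (subst T (sym b0) _)) λ ()
... | false = count≡1 (b ∘ suc) n (s≤s⁻¹ M<n) bM λ s bs → suc-injective (only (suc s) bs)

count≡2 : ∀ b n {M} → 0 < M → M < n → T (b 0) → T (b M) → (∀ s → T (b s) → s ≡ 0 ⊎ s ≡ M) →
  count b n ≡ 2
count≡2 b (suc n) {suc M} _ M<n b0 bM only with b 0
... | true = cong suc (count≡1 (b ∘ suc) n (s≤s⁻¹ M<n) bM λ s bs →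
               [ (λ ()) , suc-injective ]′ (only (suc s) bs))

occurrences≡count : ∀ {ℓ} (p : Pattern ℓ) w → occurrences p w ≡ count (isOcc p w) (length w)
occurrences≡count p w = length-filter-applyUpTo (isOcc p w) id (length w)

module _ {m : ℕ} (p : Pattern (suc m)) (ue : UniqueExtendableℓ p) {w : List ℕ}
         (len : length w ≡ suc m + m) (pos : All (0 <_) w) where

  two-occurrences⇒ends : occurrences p w ≡ 2 → OccursAt p w 0 × OccursAt p w m
  two-occurrences⇒ends two
    with s , t , s<t , _ , bs , bt ← count≥2⇒∃₂ (isOcc p w) (length w)
                                       (≤-reflexive (trans (sym two) (occurrences≡count p w)))
    with oₛ ← to (isOcc⇔OccursAt p w s) bs | oₜ ← to (isOcc⇔OccursAt p w t) bt
    with refl , refl ← occurrences-at-ends p ue len pos oₛ oₜ s<t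
    = oₛ , oₜ

  ends⇒two-occurrences : 0 < m → OccursAt p w 0 → OccursAt p w m → occurrences p w ≡ 2
  ends⇒two-occurrences 0<m o₀ oₘ = trans (occurrences≡count p w)
    (count≡2 (isOcc p w) (length w) 0<m (subst (m <_) (sym len) (s≤s (m≤n+m m m)))
      (from (isOcc⇔OccursAt p w 0) o₀) (from (isOcc⇔OccursAt p w m) oₘ) only-ends)
    where
    only-ends : ∀ s → T (isOcc p w s) → s ≡ 0 ⊎ s ≡ m
    only-ends zero    _  = inj₁ refl
    only-ends (suc s) bs =
      inj₂ (proj₂ (occurrences-at-ends p ue len pos o₀ (to (isOcc⇔OccursAt p w (suc s)) bs) z<s))

countLetter≡count : ∀ x w → countLetter x w ≡ count (λ i → at w i ≡ᵇ x) (length w)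
countLetter≡count x []      = refl
countLetter≡count x (y ∷ w) with y ≡ᵇ x
... | true  = cong suc (countLetter≡count x w)
... | false = countLetter≡count x w

countLetter≥2⇒positions : ∀ x w → 2 ≤ countLetter x w →
  ∃[ i ] ∃[ j ] i < j × j < length w × at w i ≡ x × at w j ≡ x
countLetter≥2⇒positions x w two
  with i , j , i<j , j<len , wi , wj ← count≥2⇒∃₂ _ (length w) (subst (2 ≤_) (countLetter≡count x w) two)
  = i , j , i<j , j<len , ≡ᵇ⇒≡ _ x wi , ≡ᵇ⇒≡ _ x wj

positions⇒countLetter≥2 : ∀ {x w i j} → i < j → j < length w → at w i ≡ x → at w j ≡ x →
  2 ≤ countLetter x w
positions⇒countLetter≥2 {x} {w} i<j j<len wi wj = subst (2 ≤_) (sym (countLetter≡count x w))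
  (∃₂⇒count≥2 _ (length w) i<j j<len (≡⇒≡ᵇ _ x wi) (≡⇒≡ᵇ _ x wj))

-- Permutations of a multiset

InAlphabet : ℕ → ℕ → Set
InAlphabet n x = 1 ≤ x × x ≤ n

∈-allWords⁻ : ∀ n k {w} → w ∈ allWords n k → length w ≡ k × All (InAlphabet n) w
∈-allWords⁻ n zero    (here refl) = refl , []
∈-allWords⁻ n (suc k) w∈
  with ws , w∈ws , ws∈ ← ∈-concat⁻′ (map (λ a → map (a ∷_) (allWords n k)) (map suc (upTo n))) w∈
  with a , a∈ , refl ← ∈-map⁻ (λ a → map (a ∷_) (allWords n k)) ws∈
  with w′ , w′∈ , refl ← ∈-map⁻ (a ∷_) w∈ws
  with i , i∈ , refl ← ∈-map⁻ suc a∈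
  with len , letters ← ∈-allWords⁻ n k w′∈
  = cong suc len , (s≤s z≤n , ∈-upTo⁻ i∈) ∷ letters

∈-allWords⁺ : ∀ n {w} → All (InAlphabet n) w → w ∈ allWords n (length w)
∈-allWords⁺ n []                                = here refl
∈-allWords⁺ n {suc i ∷ w} ((_ , i<n) ∷ letters) =
  ∈-concat⁺′ (∈-map⁺ (suc i ∷_) (∈-allWords⁺ n letters))
    (∈-map⁺ (λ a → map (a ∷_) (allWords n (length w))) (∈-map⁺ suc (∈-upTo⁺ i<n)))

content : ∀ n → List ℕ → Fin n → ℕ
content n w j = countLetter (suc (toℕ j)) w

HasContent : ∀ {n} → (Fin n → ℕ) → List ℕ → Set
HasContent k w = ∀ j → countLetter (suc (toℕ j)) w ≡ k j

isPermOfM⇔HasContent : ∀ {n} (k : Fin n → ℕ) w → T (isPermOfM k w) ⇔ HasContent k w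
isPermOfM⇔HasContent k w = mk⇔
  (λ t j → ≡ᵇ⇒≡ _ _ (All.lookup (All.map⁻ (to (T-and _) t)) (∈-allFin j)))
  (λ c → from (T-and _) (All.map⁺ (All.tabulate⁺ λ j → ≡⇒≡ᵇ _ _ (c j))))

module Sum = Algebra.Properties.CommutativeMonoid.Sum +-0-commutativeMonoid

Σk≡sum : ∀ {n} (k : Fin n → ℕ) → Σk k ≡ Sum.sum k
Σk≡sum k = trans (cong sum (map-tabulate id k)) (sum-tabulate k)
  where
  sum-tabulate : ∀ {n} (f : Fin n → ℕ) → sum (tabulate f) ≡ Sum.sum f
  sum-tabulate {zero}  f = refl
  sum-tabulate {suc n} f = cong (f zero +_) (sum-tabulate (f ∘ Fin.suc))

Σk-permute : ∀ {n} (k : Fin n → ℕ) (τ : Permutation′ n) → Σk (k ∘ (τ ⟨$⟩ˡ_)) ≡ Σk k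
Σk-permute k τ = trans (Σk≡sum (k ∘ (τ ⟨$⟩ˡ_)))
  (trans (sym (Sum.sum-permute k (flip τ))) (sym (Σk≡sum k)))

countLetter-∷ : ∀ x y w → countLetter x (y ∷ w) ≡ (if y ≡ᵇ x then 1 else 0) + countLetter x w
countLetter-∷ x y w with y ≡ᵇ x
... | true  = refl
... | false = refl

sum-indicator : ∀ {n y} → InAlphabet n y → Sum.sum {n} (λ j → if y ≡ᵇ suc (toℕ j) then 1 else 0) ≡ 1
sum-indicator {suc n} {suc zero}    _             = cong suc (Sum.sum-replicate-zero n)
sum-indicator {suc n} {suc (suc y)} (_ , s≤s y<n) = sum-indicator {n} {suc y} (s≤s z≤n , y<n)

Σk-content : ∀ n {w} → All (InAlphabet n) w → Σk (content n w) ≡ length w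
Σk-content n {w} letters = trans (Σk≡sum (content n w)) (sum-content letters)
  where
  sum-content : ∀ {w} → All (InAlphabet n) w → Sum.sum (content n w) ≡ length w
  sum-content []                     = Sum.sum-replicate-zero n
  sum-content {y ∷ w} (y∈ ∷ letters) = begin
    Sum.sum (content n (y ∷ w))
      ≡⟨ Sum.sum-cong-≗ {n} (λ j → countLetter-∷ (suc (toℕ j)) y w) ⟩
    Sum.sum {n} (λ j → (if y ≡ᵇ suc (toℕ j) then 1 else 0) + content n w j)
      ≡⟨ Sum.∑-distrib-+ _ (content n w) ⟩
    Sum.sum {n} (λ j → if y ≡ᵇ suc (toℕ j) then 1 else 0) + Sum.sum (content n w)
      ≡⟨ cong₂ _+_ (sum-indicator y∈) (sum-content letters) ⟩
    suc (length w) ∎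
    where open ≡-Reasoning

∈⇒length≢0 : ∀ {A : Set} {x : A} {xs} → x ∈ xs → length xs ≢ 0
∈⇒length≢0 (here _)  ()
∈⇒length≢0 (there _) ()

unstable-by-witness : ∀ {ℓ} (p : Pattern ℓ) {s n} (v : List ℕ) (τ : Permutation′ n) →
  All (InAlphabet n) v → occurrences p v ≡ s →
  (∀ w → length w ≡ length v → All (InAlphabet n) w →
     HasContent (content n v ∘ (τ ⟨$⟩ˡ_)) w → occurrences p w ≢ s) →
  UnstableProperty p s
unstable-by-witness p {s} {n} v τ v-letters v-occ no-word = n , k , τ , count-k≢count-k′
  where
  k k′ : Fin n → ℕ
  k  = content n v
  k′ = k ∘ (τ ⟨$⟩ˡ_)
  counted : (Fin n → ℕ) → List ℕ → Bool
  counted c w = isPermOfM c w ∧ (occurrences p w ≡ᵇ s)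
  Σk≡length : Σk k ≡ length v
  Σk≡length = Σk-content n v-letters
  v-counted : v ∈ filter (λ w → T? (counted k w)) (allWords n (Σk k))
  v-counted = ∈-filter⁺ (λ w → T? (counted k w))
    (subst (λ l → v ∈ allWords n l) (sym Σk≡length) (∈-allWords⁺ n v-letters))
    (from T-∧ (from (isPermOfM⇔HasContent k v) (λ _ → refl) , ≡⇒≡ᵇ _ _ v-occ))
  nothing-counted : ∀ {w} → w ∈ allWords n (Σk k′) → ¬ T (counted k′ w)
  nothing-counted {w} w∈ t with len , letters ← ∈-allWords⁻ n _ w∈ | perm , occ ← to T-∧ t =
    no-word w (trans len (trans (Σk-permute k τ) Σk≡length)) letters
      (to (isPermOfM⇔HasContent k′ w) perm) (≡ᵇ⇒≡ _ _ occ)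
  count-k≢count-k′ : countMstar k p s ≢ countMstar k′ p s
  count-k≢count-k′ eq = ∈⇒length≢0 v-counted (trans eq
    (cong length (filter-none (λ w → T? (counted k′ w)) (All.tabulate nothing-counted))))

-- Words of length 2ℓ - 1 with occurrences at both ends

above-initial-segment : ∀ μ {c} → 1 ≤ c → (∀ (y : Fin μ) → suc (toℕ y) ≢ c) → μ < c
above-initial-segment μ {suc c} _ avoids with μ ≤? c
... | yes μ≤c = s≤s μ≤c
... | no  μ≰c = contradiction (cong suc (toℕ-fromℕ< (≰⇒> μ≰c))) (avoids (fromℕ< (≰⇒> μ≰c)))

module TwoOccurrences {m : ℕ} (p : Pattern (suc m)) {w : List ℕ} (len : length w ≡ suc m + m)
                      (o₁ : OccursAt p w 0) (o₂ : OccursAt p w m) where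

  middle : ℕ
  middle = at w m

  middle₁ : factor w 0 (fromℕ m) ≡ middle
  middle₁ = cong (at w) (toℕ-fromℕ m)

  middle₂ : factor w m (zero {m}) ≡ middle
  middle₂ = cong (at w) (+-identityʳ m)

  record Split (x : ℕ) : Set where
    field
      first   : Fin (suc m)
      second  : Fin (suc m)
      first<m : toℕ first < m
      letter₁ : factor w 0 first ≡ x
      letter₂ : factor w m second ≡ x

  repeated-split : ∀ {x} → 2 ≤ countLetter x w → Split x
  repeated-split {x} two
    with i , j , i<j , j<len , wi , wj ← countLetter≥2⇒positions x w two
    with j ≤? m | m ≤? i
  ... | yes j≤m | _ = contradiction (trans wi (sym wj)) (occursAt-distinct p o₁ z≤n i<j (s≤s j≤m))
  ... | no _ | yes m≤i = contradiction (trans wi (sym wj)) (occursAt-distinct p o₂ m≤i i<j j<m+ℓ)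
    where
    j<m+ℓ : j < m + suc m
    j<m+ℓ = subst (j <_) (trans len (+-comm (suc m) m)) j<len
  ... | no j≰m | no m≰i = record
    { first   = fromℕ< i<ℓ
    ; second  = fromℕ< j∸m<ℓ
    ; first<m = subst (_< m) (sym (toℕ-fromℕ< i<ℓ)) (≰⇒> m≰i)
    ; letter₁ = trans (factor-fromℕ< p w z≤n i<ℓ) wi
    ; letter₂ = trans (factor-fromℕ< p w (<⇒≤ (≰⇒> j≰m)) j∸m<ℓ) wj
    }
    where
    i<ℓ : i < suc m
    i<ℓ = m<n⇒m<1+n (≰⇒> m≰i)
    j∸m<ℓ : j ∸ m < suc m
    j∸m<ℓ = m<n+o⇒m∸n<o j m (subst (j <_) (trans len (+-comm (suc m) m)) j<len)

  before-middle≢middle : ∀ {I : Fin (suc m)} → toℕ I < m → factor w 0 I ≢ middle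
  before-middle≢middle I<m = occursAt-distinct p o₁ z≤n I<m ≤-refl

  repeated<middle : rank p (fromℕ m) ≡ m ⊎ rank p zero ≡ m → ∀ {x} → 2 ≤ countLetter x w →
    x < middle
  repeated<middle end-max {x} two = ≤∧≢⇒< x≤middle (before-middle≢middle first<m ∘ trans letter₁)
    where
    open Split (repeated-split two)
    x≤middle : x ≤ middle
    x≤middle = [ (λ last-max  → subst₂ _≤_ letter₁ middle₁ (occursAt-max p o₁ (fromℕ m) last-max first))
               , (λ first-max → subst₂ _≤_ letter₂ middle₂ (occursAt-max p o₂ zero first-max second))
               ]′ end-max

  doubled-prefix-bound : 1 ≤ middle → ∀ {μ} → (∀ (y : Fin μ) → 2 ≤ countLetter (suc (toℕ y)) w) →
    μ ≤ rank p (fromℕ m) × μ ≤ rank p zero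
  doubled-prefix-bound 1≤middle {μ} doubled =
    occursAt-rank-bound p o₁ (fromℕ m) (Split.first ∘ split) (Split.letter₁ ∘ split)
      (λ y → subst (suc (toℕ y) <_) (sym middle₁) (below y)) ,
    occursAt-rank-bound p o₂ zero (Split.second ∘ split) (Split.letter₂ ∘ split)
      (λ y → subst (suc (toℕ y) <_) (sym middle₂) (below y))
    where
    split : ∀ (y : Fin μ) → Split (suc (toℕ y))
    split y = repeated-split (doubled y)
    μ<middle : μ < middle
    μ<middle = above-initial-segment μ 1≤middle λ y →
      before-middle≢middle (Split.first<m (split y)) ∘ trans (Split.letter₁ (split y))
    below : ∀ (y : Fin μ) → suc (toℕ y) < middle
    below y = <-≤-trans (s≤s (toℕ<n y)) μ<middle

-- The witness word

step : ℕ → ℕ → ℕ → ℕ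
step t c r with t ≤? r
... | yes _ = c
... | no  _ = 0

step-below : ∀ {t c r} → r < t → step t c r ≡ 0
step-below {t} {c} {r} r<t with t ≤? r
... | yes t≤r = contradiction t≤r (<⇒≱ r<t)
... | no  _   = refl

step-above : ∀ {t c r} → t ≤ r → step t c r ≡ c
step-above {t} {c} {r} t≤r with t ≤? r
... | yes _   = refl
... | no  t≰r = contradiction t≤r t≰r

step-mono : ∀ t c → step t c Preserves _≤_ ⟶ _≤_
step-mono t c {r} {r′} r≤r′ with t ≤? r | t ≤? r′
... | yes _   | yes _    = ≤-refl
... | yes t≤r | no  t≰r′ = contradiction (≤-trans t≤r r≤r′) t≰r′
... | no  _   | _        = z≤n

step-≤ : ∀ t c r → step t c r ≤ c
step-≤ t c r with t ≤? r
... | yes _ = ≤-refl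
... | no  _ = z≤n

module Witness {m : ℕ} (p : Pattern (suc m)) (0<m : 0 < m) (top : ℕ)
               (α<top : rank p (fromℕ m) < top) (β<top : rank p zero < top) where

  α β : ℕ
  α = rank p (fromℕ m)
  β = rank p zero

  -- Letter for rank r in an occurrence whose middle letter has rank a there and rank b in the
  -- other one. The shift by b from rank a on makes the middle letter a + b + 1 in both
  -- occurrences, ranks below a and b keep the letter r + 1 in both, and the shift by a from
  -- rank top on makes both letters of rank m equal to m + a + b + 1 when top = m.
  shifted : ℕ → ℕ → ℕ → ℕ
  shifted a b r = suc r + step a b r + step top a r

  shifted-increasing : ∀ a b → shifted a b Preserves _<_ ⟶ _<_
  shifted-increasing a b r<r′ =
    +-mono-<-≤ (+-mono-<-≤ (s<s r<r′) (step-mono a b (<⇒≤ r<r′))) (step-mono top a (<⇒≤ r<r′))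

  below-shifted : ∀ a b r → r < shifted a b r
  below-shifted a b r = s≤s (≤-trans (m≤m+n r _) (m≤m+n (r + _) _))

  shifted-at : ∀ {a b} → a < top → shifted a b a ≡ suc (a + b)
  shifted-at {a} {b} a<top =
    trans (cong₂ (λ x y → suc a + x + y) (step-above ≤-refl) (step-below a<top))
          (cong suc (+-identityʳ (a + b)))

  shifted-below : ∀ {a b r} → r < a → a < top → shifted a b r ≡ suc r
  shifted-below {a} {b} {r} r<a a<top =
    trans (cong₂ (λ x y → suc r + x + y) (step-below r<a) (step-below (<-trans r<a a<top)))
          (cong suc (trans (+-identityʳ (r + 0)) (+-identityʳ r)))

  shifted-above : ∀ {a b r} → top ≤ r → a ≤ r → shifted a b r ≡ suc (r + b + a)
  shifted-above top≤r a≤r = cong₂ (λ x y → suc _ + x + y) (step-above a≤r) (step-above top≤r)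

  alphabet : ℕ
  alphabet = suc m + m + m

  shifted-bound : ∀ {a b r} → a ≤ m → b ≤ m → r ≤ m → shifted a b r ≤ alphabet
  shifted-bound {a} {b} {r} a≤m b≤m r≤m =
    +-mono-≤ (+-mono-≤ (s≤s r≤m) (≤-trans (step-≤ a b r) b≤m)) (≤-trans (step-≤ top a r) a≤m)

  F G : ℕ → ℕ
  F = shifted α β
  G = shifted β α

  F-middle≡G-middle : F α ≡ G β
  F-middle≡G-middle = trans (shifted-at α<top) (trans (cong suc (+-comm α β)) (sym (shifted-at β<top)))

  word : List ℕ
  word = tabulate (F ∘ rank p) ++ tabulate (G ∘ rank p ∘ Fin.suc)

  length-word : length word ≡ suc m + m
  length-word = trans (length-++ (tabulate (F ∘ rank p)))
    (cong₂ _+_ (length-tabulate (F ∘ rank p)) (length-tabulate (G ∘ rank p ∘ Fin.suc)))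

  at-first : ∀ j → at word (toℕ j) ≡ F (rank p j)
  at-first j = trans
    (at-++ˡ (tabulate (F ∘ rank p)) _ (toℕ j)
      (subst (toℕ j <_) (sym (length-tabulate (F ∘ rank p))) (toℕ<n j)))
    (at-tabulate (F ∘ rank p) j)

  at-second : ∀ j → at word (m + toℕ j) ≡ G (rank p j)
  at-second zero = begin
    at word (m + 0)         ≡⟨ cong (at word) (trans (+-identityʳ m) (sym (toℕ-fromℕ m))) ⟩
    at word (toℕ (fromℕ m)) ≡⟨ at-first (fromℕ m) ⟩
    F α                     ≡⟨ F-middle≡G-middle ⟩
    G β                     ∎
    where open ≡-Reasoning
  at-second (Fin.suc j) = begin
    at word (m + suc (toℕ j))                        ≡⟨ cong (at word) (+-suc m (toℕ j)) ⟩
    at word (suc m + toℕ j)                          ≡⟨ cong (λ l → at word (l + toℕ j))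
                                                             (length-tabulate (F ∘ rank p)) ⟨
    at word (length (tabulate (F ∘ rank p)) + toℕ j) ≡⟨ at-++ʳ (tabulate (F ∘ rank p)) _ (toℕ j) ⟩
    at (tabulate (G ∘ rank p ∘ Fin.suc)) (toℕ j)     ≡⟨ at-tabulate (G ∘ rank p ∘ Fin.suc) j ⟩
    G (rank p (Fin.suc j))                           ∎
    where open ≡-Reasoning

  occurs-first : OccursAt p word 0
  occurs-first = occursAt (subst (suc m ≤_) (sym length-word) (m≤m+n (suc m) m))
    (sameOrder-congˡ (sym ∘ at-first) (strictlyIncreasing-sameOrder (shifted-increasing α β) (rank p)))

  occurs-second : OccursAt p word m
  occurs-second = occursAt (subst (m + suc m ≤_) (sym length-word) (≤-reflexive (+-comm m (suc m))))
    (sameOrder-congˡ (sym ∘ at-second) (strictlyIncreasing-sameOrder (shifted-increasing β α) (rank p)))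

  word-letters : All (InAlphabet alphabet) word
  word-letters = All.++⁺
    (All.tabulate⁺ λ j → s≤s z≤n , shifted-bound α≤m β≤m (rank≤m p j))
    (All.tabulate⁺ λ j → s≤s z≤n , shifted-bound β≤m α≤m (rank≤m p (Fin.suc j)))
    where
    α≤m : α ≤ m
    α≤m = rank≤m p (fromℕ m)
    β≤m : β ≤ m
    β≤m = rank≤m p zero

  two-occurrences : UniqueExtendableℓ p → occurrences p word ≡ 2
  two-occurrences ue = ends⇒two-occurrences p ue length-word (All.map proj₁ word-letters) 0<m
    occurs-first occurs-second

  doubled : ∀ {r} → r < suc m → F r ≡ G r → 2 ≤ countLetter (F r) word
  doubled {r} r<ℓ Fr≡Gr = positions⇒countLetter≥2 {i = toℕ j} {j = m + toℕ j}
    (m<n+m (toℕ j) 0<m)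
    (subst (m + toℕ j <_) (trans (+-comm m (suc m)) (sym length-word)) (+-monoʳ-< m (toℕ<n j)))
    (trans (at-first j) (cong F rank-j)) (trans (at-second j) (trans (cong G rank-j) (sym Fr≡Gr)))
    where
    j : Fin (suc m)
    j = p ⟨$⟩ˡ fromℕ< r<ℓ
    rank-j : rank p j ≡ r
    rank-j = trans (rank-inverse p (fromℕ< r<ℓ)) (toℕ-fromℕ< r<ℓ)

-- Instability

transpose-swaps : ∀ {n} (i j : Fin n) → transpose i j ⟨$⟩ˡ j ≡ i
transpose-swaps i j with j Fin.≟ j
... | yes _   = refl
... | no  j≢j = contradiction refl j≢j

transpose-fixes : ∀ {n} (i j : Fin n) {k} → k ≢ i → k ≢ j → transpose i j ⟨$⟩ˡ k ≡ k
transpose-fixes i j {k} k≢i k≢j with k Fin.≟ j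
... | yes k≡j = contradiction k≡j k≢j
... | no  _ with k Fin.≟ i
...   | yes k≡i = contradiction k≡i k≢i
...   | no  _   = refl

module _ {m : ℕ} (p : Pattern (suc m)) (ue : UniqueExtendableℓ p) where

  unstable-if-end-max : 1 ≤ rank p (fromℕ m) → 1 ≤ rank p zero →
    rank p (fromℕ m) ≡ m ⊎ rank p zero ≡ m → UnstableProperty p 2
  unstable-if-end-max 1≤α 1≤β end-max =
    unstable-by-witness p word τ word-letters (two-occurrences ue) no-word
    where
    0<m : 0 < m
    0<m = ≤-trans 1≤α (rank≤m p (fromℕ m))
    -- top = suc m: no rank reaches the top shift.
    open Witness p 0<m (suc m) (rank<ℓ p (fromℕ m)) (rank<ℓ p zero)
    last : Fin alphabet
    last = fromℕ (m + m + m)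
    τ : Permutation′ alphabet
    τ = transpose zero last
    one-doubled : 2 ≤ countLetter 1 word
    one-doubled = subst (λ x → 2 ≤ countLetter x word) F0≡1 (doubled z<s (trans F0≡1 (sym G0≡1)))
      where
      F0≡1 : F 0 ≡ 1
      F0≡1 = shifted-below 1≤α (rank<ℓ p (fromℕ m))
      G0≡1 : G 0 ≡ 1
      G0≡1 = shifted-below 1≤β (rank<ℓ p zero)
    no-word : ∀ w → length w ≡ length word → All (InAlphabet alphabet) w →
      HasContent (content alphabet word ∘ (τ ⟨$⟩ˡ_)) w → occurrences p w ≢ 2
    no-word w len letters has-content two =
      <⇒≱ (repeated<middle end-max last-doubled) (proj₂ (All-at letters m<len))
      where
      len′ : length w ≡ suc m + m
      len′ = trans len length-word
      m<len : m < length w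
      m<len = subst (m <_) (sym len′) (s≤s (m≤m+n m m))
      ends : OccursAt p w 0 × OccursAt p w m
      ends = two-occurrences⇒ends p ue len′ (All.map proj₁ letters) two
      open TwoOccurrences p len′ (proj₁ ends) (proj₂ ends)
      last-doubled : 2 ≤ countLetter alphabet w
      last-doubled = subst (2 ≤_) (sym (begin
        countLetter (suc (m + m + m)) w     ≡⟨ cong (λ x → countLetter (suc x) w) (toℕ-fromℕ _) ⟨
        countLetter (suc (toℕ last)) w      ≡⟨ has-content last ⟩
        content alphabet word (τ ⟨$⟩ˡ last) ≡⟨ cong (content alphabet word) (transpose-swaps zero last) ⟩
        countLetter 1 word                  ∎)) one-doubled
        where open ≡-Reasoning

  unstable-if-ends-inner : rank p (fromℕ m) < m → rank p zero < m → UnstableProperty p 2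
  unstable-if-ends-inner α<m β<m =
    unstable-by-witness p word τ word-letters (two-occurrences ue) no-word
    where
    open Witness p (≤-<-trans z≤n α<m) m α<m β<m
    d : ℕ
    d = α ⊓ β
    d<m : d < m
    d<m = ≤-<-trans (m⊓n≤m α β) α<m
    bottom-doubled : ∀ {r} → r < d → 2 ≤ countLetter (suc r) word
    bottom-doubled {r} r<d = subst (λ x → 2 ≤ countLetter x word) Fr≡1+r
      (doubled (<-trans r<d (<-trans d<m (n<1+n m))) (trans Fr≡1+r (sym Gr≡1+r)))
      where
      Fr≡1+r : F r ≡ suc r
      Fr≡1+r = shifted-below (<-≤-trans r<d (m⊓n≤m α β)) α<m
      Gr≡1+r : G r ≡ suc r
      Gr≡1+r = shifted-below (<-≤-trans r<d (m⊓n≤n α β)) β<m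
    top-doubled : 2 ≤ countLetter (F m) word
    top-doubled = doubled (n<1+n m) (begin
      F m             ≡⟨ shifted-above ≤-refl (<⇒≤ α<m) ⟩
      suc (m + β + α) ≡⟨ cong suc (trans (+-assoc m β α)
                           (trans (cong (m +_) (+-comm β α)) (sym (+-assoc m α β)))) ⟩
      suc (m + α + β) ≡⟨ shifted-above ≤-refl (<⇒≤ β<m) ⟨
      G m             ∎)
      where open ≡-Reasoning
    top : Fin alphabet
    top = fromℕ< (shifted-bound (<⇒≤ α<m) (<⇒≤ β<m) (≤-refl {m}))
    1+top≡Fm : suc (toℕ top) ≡ F m
    1+top≡Fm = cong suc (toℕ-fromℕ< _)
    d<alphabet : d < alphabet
    d<alphabet = <-trans d<m (s≤s (≤-trans (m≤m+n m m) (m≤m+n (m + m) m)))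
    d′ : Fin alphabet
    d′ = fromℕ< d<alphabet
    τ : Permutation′ alphabet
    τ = transpose top d′
    m≤top : m ≤ toℕ top
    m≤top = s≤s⁻¹ (subst (m <_) (sym 1+top≡Fm) (below-shifted α β m))
    permuted-doubled : ∀ {x} (x<alphabet : x < alphabet) → x ≤ d →
      2 ≤ content alphabet word (τ ⟨$⟩ˡ fromℕ< x<alphabet)
    permuted-doubled {x} x<alphabet x≤d with x <? d
    ... | yes x<d = subst (λ i → 2 ≤ content alphabet word i) (sym (transpose-fixes top d′ x′≢top x′≢d′))
      (subst (λ y → 2 ≤ countLetter (suc y) word) (sym toℕ-x′) (bottom-doubled x<d))
      where
      toℕ-x′ : toℕ (fromℕ< x<alphabet) ≡ x
      toℕ-x′ = toℕ-fromℕ< x<alphabet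
      x′≢top : fromℕ< x<alphabet ≢ top
      x′≢top x′≡top = <⇒≢ (<-≤-trans (<-trans x<d d<m) m≤top) (trans (sym toℕ-x′) (cong toℕ x′≡top))
      x′≢d′ : fromℕ< x<alphabet ≢ d′
      x′≢d′ x′≡d′ = <⇒≢ x<d (trans (sym toℕ-x′) (trans (cong toℕ x′≡d′) (toℕ-fromℕ< d<alphabet)))
    ... | no x≮d = subst (λ i → 2 ≤ content alphabet word i)
      (sym (trans (cong (τ ⟨$⟩ˡ_) (fromℕ<-cong _ _ (≤-antisym x≤d (≮⇒≥ x≮d)) x<alphabet d<alphabet))
                  (transpose-swaps top d′)))
      (subst (λ y → 2 ≤ countLetter y word) (sym 1+top≡Fm) top-doubled)
    no-word : ∀ w → length w ≡ length word → All (InAlphabet alphabet) w →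
      HasContent (content alphabet word ∘ (τ ⟨$⟩ˡ_)) w → occurrences p w ≢ 2
    no-word w len letters has-content two = n≮n d (⊓-glb (proj₁ bound) (proj₂ bound))
      where
      len′ : length w ≡ suc m + m
      len′ = trans len length-word
      ends : OccursAt p w 0 × OccursAt p w m
      ends = two-occurrences⇒ends p ue len′ (All.map proj₁ letters) two
      open TwoOccurrences p len′ (proj₁ ends) (proj₂ ends)
      first-letters-doubled : ∀ (y : Fin (suc d)) → 2 ≤ countLetter (suc (toℕ y)) w
      first-letters-doubled y = subst (2 ≤_)
        (sym (trans (cong (λ x → countLetter (suc x) w) (sym (toℕ-fromℕ< y<alphabet))) (has-content _)))
        (permuted-doubled y<alphabet (s≤s⁻¹ (toℕ<n y)))
        where
        y<alphabet : toℕ y < alphabet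
        y<alphabet = ≤-<-trans (s≤s⁻¹ (toℕ<n y)) d<alphabet
      bound : suc d ≤ α × suc d ≤ β
      bound = doubled-prefix-bound (proj₁ (All-at letters (subst (m <_) (sym len′) (s≤s (m≤m+n m m)))))
        first-letters-doubled

  unstable-if-ends-not-extreme :
    ¬ ((pval p zero ≡ 1 × pval p (fromℕ m) ≡ suc m) ⊎ (pval p zero ≡ suc m × pval p (fromℕ m) ≡ 1)) →
    UnstableProperty p 2
  unstable-if-ends-not-extreme not-extreme with rank p (fromℕ m) ≟ m | rank p zero ≟ m
  ... | yes α≡m | _ = unstable-if-end-max 1≤α 1≤β (inj₁ α≡m)
    where
    1≤β : 1 ≤ rank p zero
    1≤β = n≢0⇒n>0 λ β≡0 → not-extreme (inj₁ (cong suc β≡0 , cong suc α≡m))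
    1≤α : 1 ≤ rank p (fromℕ m)
    1≤α = subst (1 ≤_) (sym α≡m) (≤-trans 1≤β (rank≤m p zero))
  ... | no _ | yes β≡m = unstable-if-end-max 1≤α 1≤β (inj₂ β≡m)
    where
    1≤α : 1 ≤ rank p (fromℕ m)
    1≤α = n≢0⇒n>0 λ α≡0 → not-extreme (inj₂ (cong suc β≡m , cong suc α≡0))
    1≤β : 1 ≤ rank p zero
    1≤β = subst (1 ≤_) (sym β≡m) (≤-trans 1≤α (rank≤m p (fromℕ m)))
  ... | no α≢m | no β≢m =
    unstable-if-ends-inner (≤∧≢⇒< (rank≤m p (fromℕ m)) α≢m) (≤∧≢⇒< (rank≤m p zero) β≢m)

corollary4p16 : (m : ℕ) → (p : Pattern (suc m)) →
    ¬ ((pval p zero ≡ 1 × pval p (fromℕ m) ≡ suc m) ⊎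
       (pval p zero ≡ suc m × pval p (fromℕ m) ≡ 1)) →
    UniqueExtendableℓ p →
    UnstableProperty p 2 × UnstablePattern p
corollary4p16 m p ends-not-extreme ue = unstable , 2 , unstable
  where
  unstable : UnstableProperty p 2
  unstable = unstable-if-ends-not-extreme p ue ends-not-extreme
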